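{- Define, for every integer $k\ge 0$, the formal power series $$A^{(k)}_{231}(x,t)=1+\sum_{n\ge 1}\Big(\sum_{\sigma\in S_n(231),\ \mathrm{maxdrop}(\sigma)\le k} x^{\mathrm{des}(\sigma)}\Big)t^n .$$ Then $A^{(0)}_{231}(x,t)=\frac{1}{1-t}$, and for all $k\ge 1$, $$A^{(k)}_{231}(x,t)=\frac{1}{1-t+tx-txA^{(k-1)}_{231}(x,t)}.$$
   Context: For a permutation $\sigma=\sigma_1\cdots\sigma_n$ of $[n]=\{1,\dots,n\}$, $\mathrm{des}(\sigma)$ is the number of $i\in[n-1]$ with $\sigma_i>\sigma_{i+1}$, and $\mathrm{maxdrop}(\sigma)=\max\{i-\sigma_i : i\in[n]\}$. $S_n(231)$ denotes the set of permutations of $[n]$ avoiding the pattern $231$, i.e. there are no indices $a<b<c$ with $\sigma_c<\sigma_a<\sigma_b$. -}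

module Defs where

open import Data.Nat using (ℕ; zero; suc; _∸_; _⊔_; _<ᵇ_; _≤ᵇ_; _≡ᵇ_)
open import Data.Bool using (Bool; true; false; not; _∧_; if_then_else_)
open import Data.List using (List; []; _∷_; map; _++_; concatMap; filter; length; upTo; foldr)
open import Data.Bool.ListAction using (any)
open import Data.Product using (_×_; _,_)
open import Data.Integer using (ℤ; +_; _+_; _*_; -_)
open import Relation.Binary.PropositionalEquality using (_≡_)
open import Relation.Nullary.Decidable using (Dec)
open import Data.Bool.Properties using () renaming (_≟_ to _≟ᵇ_)

-- Permutations as lists σ₁ ⋯ σₙ of natural numbers (one-line notation).

words : ℕ → ℕ → List (List ℕ)
words m zero    = [] ∷ []
words m (suc n) = concatMap (λ v → map (v ∷_) (words m n)) (map suc (upTo m))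

elem : ℕ → List ℕ → Bool
elem x xs = any (x ≡ᵇ_) xs

distinct : List ℕ → Bool
distinct []       = true
distinct (x ∷ xs) = not (elem x xs) ∧ distinct xs

perms : ℕ → List (List ℕ)
perms n = filter (λ σ → distinct σ ≟ᵇ true) (words n n)

pairs : List ℕ → List (ℕ × ℕ)
pairs []       = []
pairs (x ∷ xs) = map (x ,_) xs ++ pairs xs

triples : List ℕ → List (ℕ × ℕ × ℕ)
triples []       = []
triples (x ∷ xs) = map (λ { (y , z) → (x , y , z) }) (pairs xs) ++ triples xs

contains231 : List ℕ → Bool
contains231 σ = any (λ { (p , q , r) → (r <ᵇ p) ∧ (p <ᵇ q) }) (triples σ)

perms231 : ℕ → List (List ℕ)
perms231 n = filter (λ σ → not (contains231 σ) ≟ᵇ true) (perms n)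

des : List ℕ → ℕ
des []           = 0
des (x ∷ [])     = 0
des (x ∷ y ∷ xs) = (if y <ᵇ x then 1 else 0) Data.Nat.+ des (y ∷ xs)

-- maxdrop σ = max_i (i - σ_i), positions 1-indexed.  For a permutation
-- this maximum is ≥ 0 (σ_n ≤ n), so truncated subtraction gives the same value.
maxdropFrom : ℕ → List ℕ → ℕ
maxdropFrom i []       = 0
maxdropFrom i (x ∷ xs) = (i ∸ x) ⊔ maxdropFrom (suc i) xs

maxdrop : List ℕ → ℕ
maxdrop σ = maxdropFrom 1 σ

-- Formal power series in t with polynomial coefficients in x, over ℤ:
-- f n d = coefficient of xᵈ tⁿ.

FPS : Set
FPS = ℕ → ℕ → ℤ

_≈_ : FPS → FPS → Set
f ≈ g = ∀ n d → f n d ≡ g n d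

sumTo : ℕ → (ℕ → ℤ) → ℤ
sumTo n h = foldr _+_ (+ 0) (map h (upTo (suc n)))

_⊕_ : FPS → FPS → FPS
(f ⊕ g) n d = f n d + g n d

_⊖_ : FPS → FPS → FPS
(f ⊖ g) n d = f n d + - g n d

_⊛_ : FPS → FPS → FPS
(f ⊛ g) n d = sumTo n (λ i → sumTo d (λ j → f i j * g (n ∸ i) (d ∸ j)))

mono : ℕ → ℕ → FPS
mono b a n d = if (n ≡ᵇ b) ∧ (d ≡ᵇ a) then + 1 else + 0

one : FPS
one = mono 0 0

tt : FPS
tt = mono 1 0

txm : FPS
txm = mono 1 1

infixl 6 _⊕_ _⊖_
infixl 7 _⊛_
infix 4 _≈_

-- A^{(k)}_{231}(x,t): coefficient of xᵈ tⁿ is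
-- #{σ ∈ S_n(231) : maxdrop σ ≤ k, des σ = d}.  (For n = 0 the only
-- element of perms231 0 is the empty word, giving the constant term 1.)
A231 : ℕ → FPS
A231 k n d = + length (filter (λ σ → ((maxdrop σ ≤ᵇ k) ∧ (des σ ≡ᵇ d)) ≟ᵇ true) (perms231 n))

module Submission where

-- Every σ ∈ S_{n+1}(231) is uniquely  α (n+1) (β + p)  with α ∈ S_p(231),
-- β ∈ S_{n-p}(231), and every such word lies in S_{n+1}(231).  Along this
-- decomposition maxdrop σ = max(maxdrop α, maxdrop' β) and des σ = des α + des' β,
-- where maxdrop' measures drops one position further right and des' also counts
-- the descent from n+1 into a nonempty β.  Hence A⁽ᵏ⁾ = 1 + t A⁽ᵏ⁾ E⁽ᵏ⁾ for the
-- series E⁽ᵏ⁾ counting β by (maxdrop' ≤ k, des'), i.e. A⁽ᵏ⁾(1 - t E⁽ᵏ⁾) = 1.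
-- Finally t E⁽⁰⁾ = t (the entry 1 of β has a positive drop) and
-- t E⁽ᵏ⁺¹⁾ = t - tx + tx A⁽ᵏ⁾ (maxdrop' ≤ k+1 iff maxdrop ≤ k, des' = 1 + des).

open import Defs
open import Data.Nat using (ℕ; suc)
open import Data.Product using (_×_)
open import Algebra.Structures using (IsCommutativeMonoid)
open import Relation.Binary.PropositionalEquality

module ListCounting where

  open import Data.Nat using (_+_; _≤_; z≤n; s≤s)
  open import Data.Nat.Properties using (≤-antisym; ≤-trans; <-irrefl; +-assoc)
  open import Data.Nat.ListAction using (sum)
  open import Data.Bool using (Bool; true; false; if_then_else_)
  open import Data.Bool.Properties using () renaming (_≟_ to _≟ᵇ_)
  open import Data.List using (List; []; _∷_; _++_; map; length; concatMap; filter)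
  open import Data.List.Membership.Propositional using (_∈_)
  open import Data.List.Membership.Propositional.Properties
    using (∈-++⁺ˡ; ∈-++⁺ʳ; ∈-++⁻; ∈-∃++; ∈-concat⁻′; ∈-map⁻; ∈-filter⁺; ∈-filter⁻)
  open import Data.List.Relation.Binary.Subset.Propositional using (_⊆_)
  open import Data.List.Relation.Unary.Any using (here; there)
  open import Data.List.Relation.Unary.All as All using (All; _∷_)
  import Data.List.Membership.DecPropositional as Dec∈
  import Data.List.Relation.Unary.All.Properties as AllP
  open import Data.List.Relation.Unary.AllPairs using ([]; _∷_)
  open import Data.List.Relation.Unary.Unique.Propositional using (Unique)
  open import Data.List.Relation.Binary.Disjoint.Propositional using (Disjoint)
  import Data.List.Relation.Unary.Unique.Propositional.Properties as Unique
  open import Data.Product using (_,_)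
  open import Data.Sum using (inj₁; inj₂)
  open import Data.Empty using (⊥; ⊥-elim)
  open import Relation.Nullary using (Dec; yes; no)
  open import Relation.Binary.Definitions using (DecidableEquality)
  open import Function using (_∘_)

  module _ {A : Set} where

    ∈-delete : ∀ (ys zs : List A) {x y} → y ∈ ys ++ x ∷ zs → y ≢ x → y ∈ ys ++ zs
    ∈-delete ys zs y∈ y≢x with ∈-++⁻ ys y∈
    ... | inj₁ p         = ∈-++⁺ˡ p
    ... | inj₂ (here e)  = ⊥-elim (y≢x e)
    ... | inj₂ (there p) = ∈-++⁺ʳ ys p

    length-delete : ∀ (ys zs : List A) x → length (ys ++ x ∷ zs) ≡ suc (length (ys ++ zs))
    length-delete []       zs x = refl
    length-delete (y ∷ ys) zs x = cong suc (length-delete ys zs x)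

    Unique-length-≤ : ∀ {xs ys : List A} → Unique xs → xs ⊆ ys → length xs ≤ length ys
    Unique-length-≤ {[]}     _          _  = z≤n
    Unique-length-≤ {x ∷ xs} (x∉ ∷ uxs) xs⊆ys with ∈-∃++ (xs⊆ys (here refl))
    ... | ys , zs , refl =
      subst (suc (length xs) ≤_) (sym (length-delete ys zs x))
        (s≤s (Unique-length-≤ uxs λ z∈ →
          ∈-delete ys zs (xs⊆ys (there z∈)) λ z≡x → All.lookup x∉ z∈ (sym z≡x)))

    pigeonhole : DecidableEquality A → ∀ {xs ys : List A} →
      Unique xs → xs ⊆ ys → length ys ≤ length xs → ys ⊆ xs
    pigeonhole _≟_ {xs} uxs xs⊆ys ys≤xs {v} v∈ys with Dec∈._∈?_ _≟_ v xs
    ... | yes v∈xs = v∈xs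
    ... | no  v∉xs with ∈-∃++ v∈ys
    ... | ys₁ , ys₂ , refl =
      ⊥-elim (<-irrefl refl (≤-trans
        (s≤s (Unique-length-≤ uxs λ z∈ →
          ∈-delete ys₁ ys₂ (xs⊆ys z∈) λ z≡v → v∉xs (subst (_∈ xs) z≡v z∈)))
        (subst (_≤ length xs) (length-delete ys₁ ys₂ v) ys≤xs)))

    Unique-++⁻ : ∀ (xs : List A) {ys} → Unique (xs ++ ys) →
      Unique xs × Unique ys × (∀ {a} → a ∈ xs → a ∈ ys → ⊥)
    Unique-++⁻ []       uys        = [] , uys , λ ()
    Unique-++⁻ (x ∷ xs) {ys} (x∉ ∷ uxys) with Unique-++⁻ xs uxys
    ... | uxs , uys , disjoint = AllP.++⁻ˡ xs x∉ ∷ uxs , uys , disjoint′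
      where
        disjoint′ : ∀ {a} → a ∈ x ∷ xs → a ∈ ys → ⊥
        disjoint′ (here refl) a∈ys = All.lookup (AllP.++⁻ʳ xs x∉) a∈ys refl
        disjoint′ (there a∈)  a∈ys = disjoint a∈ a∈ys

    Unique-concatMap : ∀ {B : Set} (f : B → List A) (label : A → B) {bs : List B} →
      Unique bs → (∀ {b} → b ∈ bs → Unique (f b)) →
      (∀ {b y} → b ∈ bs → y ∈ f b → label y ≡ b) → Unique (concatMap f bs)
    Unique-concatMap f label {[]}     _          _   _     = []
    Unique-concatMap f label {b ∷ bs} (b∉ ∷ ubs) ufs label≡ =
      Unique.++⁺ (ufs (here refl))
        (Unique-concatMap f label ubs (ufs ∘ there) (label≡ ∘ there))
        disjoint
      where
        disjoint : Disjoint (f b) (concatMap f bs)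
        disjoint (y∈fb , y∈rest) with ∈-concat⁻′ (map f bs) y∈rest
        ... | _ , y∈fb′ , fb′∈ with ∈-map⁻ f fb′∈
        ... | b′ , b′∈ , refl = All.lookup b∉ b′∈
          (trans (sym (label≡ (here refl) y∈fb)) (label≡ (there b′∈) y∈fb′))

  indicator : Bool → ℕ
  indicator b = if b then 1 else 0

  module _ {A : Set} where

    count : (A → Bool) → List A → ℕ
    count f []       = 0
    count f (x ∷ xs) = indicator (f x) + count f xs

    length-filter : ∀ f (xs : List A) → length (filter (λ x → f x ≟ᵇ true) xs) ≡ count f xs
    length-filter f []       = refl
    length-filter f (x ∷ xs) with f x
    ... | true  = cong suc (length-filter f xs)
    ... | false = length-filter f xs

    count-++ : ∀ f (xs ys : List A) → count f (xs ++ ys) ≡ count f xs + count f ys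
    count-++ f []       ys = refl
    count-++ f (x ∷ xs) ys =
      trans (cong (indicator (f x) +_) (count-++ f xs ys)) (sym (+-assoc (indicator (f x)) _ _))

    count-cong : ∀ f g (xs : List A) → (∀ {x} → x ∈ xs → f x ≡ g x) → count f xs ≡ count g xs
    count-cong f g []       _   = refl
    count-cong f g (x ∷ xs) f≡g =
      cong₂ (λ b n → indicator b + n) (f≡g (here refl)) (count-cong f g xs (f≡g ∘ there))

    count-none : ∀ f (xs : List A) → (∀ {x} → x ∈ xs → f x ≡ false) → count f xs ≡ 0
    count-none f []       _     = refl
    count-none f (x ∷ xs) none rewrite none (here refl) = count-none f xs (none ∘ there)

    count-same-elements : ∀ f {xs ys : List A} → Unique xs → Unique ys →
      xs ⊆ ys → ys ⊆ xs → count f xs ≡ count f ys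
    count-same-elements f {xs} {ys} uxs uys xs⊆ys ys⊆xs = begin
      count f xs                 ≡⟨ length-filter f xs ⟨
      length (filter test xs)    ≡⟨ ≤-antisym (bound uxs xs⊆ys) (bound uys ys⊆xs) ⟩
      length (filter test ys)    ≡⟨ length-filter f ys ⟩
      count f ys                 ∎
      where
        open ≡-Reasoning
        test : ∀ x → Dec (f x ≡ true)
        test x = f x ≟ᵇ true
        filter-⊆ : ∀ {as bs} → as ⊆ bs → filter test as ⊆ filter test bs
        filter-⊆ as⊆bs z∈ with ∈-filter⁻ test z∈
        ... | z∈as , fz = ∈-filter⁺ test (as⊆bs z∈as) fz
        bound : ∀ {as bs} → Unique as → as ⊆ bs → length (filter test as) ≤ length (filter test bs)
        bound uas as⊆bs = Unique-length-≤ (Unique.filter⁺ test uas) (filter-⊆ as⊆bs)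

  count-map : ∀ {A B : Set} (f : B → Bool) (g : A → B) xs →
    count f (map g xs) ≡ count (λ x → f (g x)) xs
  count-map f g []       = refl
  count-map f g (x ∷ xs) = cong (indicator (f (g x)) +_) (count-map f g xs)

  count-concatMap : ∀ {A B : Set} (f : B → Bool) (g : A → List B) xs →
    count f (concatMap g xs) ≡ sum (map (λ x → count f (g x)) xs)
  count-concatMap f g []       = refl
  count-concatMap f g (x ∷ xs) =
    trans (count-++ f (g x) (concatMap g xs)) (cong (count f (g x) +_) (count-concatMap f g xs))

module FiniteSums {A : Set} {_∙_ : A → A → A} {ε : A}
                  (isCM : IsCommutativeMonoid _≡_ _∙_ ε) where

  open import Data.Nat using (zero; _<_; z≤n; s≤s)
  open import Data.Nat.Properties using (suc-injective)
  open import Data.List using (List; []; _∷_; map; foldr; applyUpTo)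
  open import Function using (_∘_)
  open IsCommutativeMonoid isCM using (identityˡ; identityʳ; assoc; comm)

  sum< : ℕ → (ℕ → A) → A
  sum< zero    g = ε
  sum< (suc m) g = g 0 ∙ sum< m (g ∘ suc)

  sum<-cong : ∀ m g h → (∀ i → i < m → g i ≡ h i) → sum< m g ≡ sum< m h
  sum<-cong zero    g h g≡h = refl
  sum<-cong (suc m) g h g≡h =
    cong₂ _∙_ (g≡h 0 (s≤s z≤n)) (sum<-cong m _ _ λ i i<m → g≡h (suc i) (s≤s i<m))

  sum<-zero : ∀ m g → (∀ i → i < m → g i ≡ ε) → sum< m g ≡ ε
  sum<-zero zero    g g≡ε = refl
  sum<-zero (suc m) g g≡ε =
    trans (cong₂ _∙_ (g≡ε 0 (s≤s z≤n)) (sum<-zero m _ λ i i<m → g≡ε (suc i) (s≤s i<m)))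
          (identityˡ ε)

  sum<-single : ∀ m g a → a < m → (∀ i → i < m → i ≢ a → g i ≡ ε) → sum< m g ≡ g a
  sum<-single (suc m) g zero    _         others =
    trans (cong (g 0 ∙_) (sum<-zero m _ λ i i<m → others (suc i) (s≤s i<m) λ ()))
          (identityʳ (g 0))
  sum<-single (suc m) g (suc a) (s≤s a<m) others =
    trans (cong₂ _∙_ (others 0 (s≤s z≤n) λ ())
                     (sum<-single m _ a a<m λ i i<m i≢a →
                        others (suc i) (s≤s i<m) (i≢a ∘ suc-injective)))
          (identityˡ _)

  sum<-last : ∀ m g → sum< (suc m) g ≡ sum< m g ∙ g m
  sum<-last zero    g = trans (identityʳ (g 0)) (sym (identityˡ (g 0)))
  sum<-last (suc m) g = trans (cong (g 0 ∙_) (sum<-last m (g ∘ suc))) (sym (assoc _ _ _))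

  sum<-∙ : ∀ m g h → sum< m (λ i → g i ∙ h i) ≡ sum< m g ∙ sum< m h
  sum<-∙ zero    g h = sym (identityˡ ε)
  sum<-∙ (suc m) g h =
    trans (cong ((g 0 ∙ h 0) ∙_) (sum<-∙ m (g ∘ suc) (h ∘ suc))) (interchange _ _ _ _)
    where
      interchange : ∀ a b c d → (a ∙ b) ∙ (c ∙ d) ≡ (a ∙ c) ∙ (b ∙ d)
      interchange a b c d = begin
        (a ∙ b) ∙ (c ∙ d)  ≡⟨ assoc a b (c ∙ d) ⟩
        a ∙ (b ∙ (c ∙ d))  ≡⟨ cong (a ∙_) (assoc b c d) ⟨
        a ∙ ((b ∙ c) ∙ d)  ≡⟨ cong (λ z → a ∙ (z ∙ d)) (comm b c) ⟩
        a ∙ ((c ∙ b) ∙ d)  ≡⟨ cong (a ∙_) (assoc c b d) ⟩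
        a ∙ (c ∙ (b ∙ d))  ≡⟨ assoc a c (b ∙ d) ⟨
        (a ∙ c) ∙ (b ∙ d)  ∎
        where open ≡-Reasoning

  foldr-applyUpTo : ∀ (h : ℕ → A) f m → foldr _∙_ ε (map h (applyUpTo f m)) ≡ sum< m (h ∘ f)
  foldr-applyUpTo h f zero    = refl
  foldr-applyUpTo h f (suc m) = cong (h (f 0) ∙_) (foldr-applyUpTo h (f ∘ suc) m)

  foldr-sum<-interchange : ∀ {B : Set} (xs : List B) m (g : B → ℕ → A) →
    foldr _∙_ ε (map (λ x → sum< m (g x)) xs) ≡ sum< m (λ j → foldr _∙_ ε (map (λ x → g x j) xs))
  foldr-sum<-interchange []       m g = sym (sum<-zero m _ λ _ _ → refl)
  foldr-sum<-interchange (x ∷ xs) m g =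
    trans (cong (sum< m (g x) ∙_) (foldr-sum<-interchange xs m g)) (sym (sum<-∙ m _ _))

module Pattern231 where

  open import Data.Nat using (_+_; _<_)
  open import Data.Nat.Properties using (<ᵇ⇒<; <⇒<ᵇ; <-asym; +-cancelˡ-<; +-monoʳ-<)
  open import Data.Bool using (T; true; false)
  open import Data.Empty using (⊥-elim)
  open import Data.Bool.Properties using (T-∧; T-≡)
  open import Data.List using (List; []; _∷_; _++_; map)
  open import Data.List.Membership.Propositional using (_∈_; find; lose)
  open import Data.List.Membership.Propositional.Properties using (∈-++⁺ˡ; ∈-++⁺ʳ; ∈-++⁻; ∈-map⁺; ∈-map⁻)
  open import Data.List.Relation.Unary.Any using (here; there)
  open import Data.List.Relation.Unary.All using (All; _∷_; lookup)
  import Data.List.Relation.Unary.Any.Properties as Any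
  open import Data.Product using (∃; _,_)
  open import Data.Sum using (_⊎_; inj₁; inj₂)
  open import Relation.Nullary using (¬_)
  open import Function using (Equivalence; _∘_)

  data SubPair (y z : ℕ) : List ℕ → Set where
    first : ∀ {ws} → z ∈ ws → SubPair y z (y ∷ ws)
    later : ∀ {w ws} → SubPair y z ws → SubPair y z (w ∷ ws)

  data SubTriple (x y z : ℕ) : List ℕ → Set where
    first : ∀ {ws} → SubPair y z ws → SubTriple x y z (x ∷ ws)
    later : ∀ {w ws} → SubTriple x y z ws → SubTriple x y z (w ∷ ws)

  Has231 : List ℕ → Set
  Has231 σ = ∃ λ x → ∃ λ y → ∃ λ z → SubTriple x y z σ × z < x × x < y

  Avoids231 : List ℕ → Set
  Avoids231 σ = contains231 σ ≡ false

  pairs⁻ : ∀ {y z} σ → (y , z) ∈ pairs σ → SubPair y z σ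
  pairs⁻ (w ∷ σ) p with ∈-++⁻ (map (w ,_) σ) p
  ... | inj₂ q = later (pairs⁻ σ q)
  ... | inj₁ q with ∈-map⁻ (w ,_) q
  ... | _ , z∈ , refl = first z∈

  pairs⁺ : ∀ {y z σ} → SubPair y z σ → (y , z) ∈ pairs σ
  pairs⁺ {y} (first z∈)     = ∈-++⁺ˡ (∈-map⁺ (y ,_) z∈)
  pairs⁺ (later {w} {ws} p) = ∈-++⁺ʳ (map (w ,_) ws) (pairs⁺ p)

  triples⁻ : ∀ {x y z} σ → (x , y , z) ∈ triples σ → SubTriple x y z σ
  triples⁻ (w ∷ σ) p with ∈-++⁻ (map (λ { (y , z) → (w , y , z) }) (pairs σ)) p
  ... | inj₂ q = later (triples⁻ σ q)
  ... | inj₁ q with ∈-map⁻ (λ { (y , z) → (w , y , z) }) q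
  ... | _ , yz∈ , refl = first (pairs⁻ σ yz∈)

  triples⁺ : ∀ {x y z σ} → SubTriple x y z σ → (x , y , z) ∈ triples σ
  triples⁺ {x} (first p)      = ∈-++⁺ˡ (∈-map⁺ (λ { (y , z) → (x , y , z) }) (pairs⁺ p))
  triples⁺ (later {w} {ws} p) = ∈-++⁺ʳ (map (λ { (y , z) → (w , y , z) }) (pairs ws)) (triples⁺ p)

  contains231⇒Has231 : ∀ σ → T (contains231 σ) → Has231 σ
  contains231⇒Has231 σ t with find (Any.any⁻ _ (triples σ) t)
  ... | (x , y , z) , m , q with Equivalence.to T-∧ q
  ... | z<ᵇx , x<ᵇy = x , y , z , triples⁻ σ m , <ᵇ⇒< z x z<ᵇx , <ᵇ⇒< x y x<ᵇy

  Has231⇒contains231 : ∀ σ → Has231 σ → T (contains231 σ)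
  Has231⇒contains231 σ (x , y , z , occ , z<x , x<y) =
    Any.any⁺ _ (lose (triples⁺ occ) (Equivalence.from T-∧ (<⇒<ᵇ z<x , <⇒<ᵇ x<y)))

  avoids⇒¬Has231 : ∀ σ → Avoids231 σ → ¬ Has231 σ
  avoids⇒¬Has231 σ av h = subst T av (Has231⇒contains231 σ h)

  ¬Has231⇒avoids : ∀ σ → ¬ Has231 σ → Avoids231 σ
  ¬Has231⇒avoids σ ¬h with contains231 σ in eq
  ... | false = refl
  ... | true  = ⊥-elim (¬h (contains231⇒Has231 σ (Equivalence.from T-≡ eq)))

  SubPair-++ˡ : ∀ {y z} ws {σ} → SubPair y z σ → SubPair y z (ws ++ σ)
  SubPair-++ˡ []       p = p
  SubPair-++ˡ (w ∷ ws) p = later (SubPair-++ˡ ws p)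

  SubPair-++ʳ : ∀ {y z σ} ws → SubPair y z σ → SubPair y z (σ ++ ws)
  SubPair-++ʳ ws (first z∈) = first (∈-++⁺ˡ z∈)
  SubPair-++ʳ ws (later p)  = later (SubPair-++ʳ ws p)

  SubTriple-++ˡ : ∀ {x y z} ws {σ} → SubTriple x y z σ → SubTriple x y z (ws ++ σ)
  SubTriple-++ˡ []       p = p
  SubTriple-++ˡ (w ∷ ws) p = later (SubTriple-++ˡ ws p)

  SubTriple-++ʳ : ∀ {x y z σ} ws → SubTriple x y z σ → SubTriple x y z (σ ++ ws)
  SubTriple-++ʳ ws (first p) = first (SubPair-++ʳ ws p)
  SubTriple-++ʳ ws (later p) = later (SubTriple-++ʳ ws p)

  SubPair-split : ∀ {y z} σ {ws} → SubPair y z (σ ++ ws) → SubPair y z σ ⊎ z ∈ ws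
  SubPair-split []      p = inj₂ (second p)
    where
      second : ∀ {y z σ} → SubPair y z σ → z ∈ σ
      second (first z∈) = there z∈
      second (later p)  = there (second p)
  SubPair-split (w ∷ σ) (first z∈) with ∈-++⁻ σ z∈
  ... | inj₁ q = inj₁ (first q)
  ... | inj₂ q = inj₂ q
  SubPair-split (w ∷ σ) (later p) with SubPair-split σ p
  ... | inj₁ q = inj₁ (later q)
  ... | inj₂ q = inj₂ q

  SubPair-head : ∀ {y z σ} → SubPair y z σ → y ∈ σ
  SubPair-head (first _) = here refl
  SubPair-head (later p) = there (SubPair-head p)

  avoids-prefix : ∀ σ τ → Avoids231 (σ ++ τ) → Avoids231 σ
  avoids-prefix σ τ av = ¬Has231⇒avoids σ λ (x , y , z , occ , lt) →
    avoids⇒¬Has231 (σ ++ τ) av (x , y , z , SubTriple-++ʳ τ occ , lt)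

  avoids-suffix : ∀ σ τ → Avoids231 (σ ++ τ) → Avoids231 τ
  avoids-suffix σ τ av = ¬Has231⇒avoids τ λ (x , y , z , occ , lt) →
    avoids⇒¬Has231 (σ ++ τ) av (x , y , z , SubTriple-++ˡ σ occ , lt)

  -- In a 231-avoider α N γ, an entry of α below N lies below every entry of γ
  -- (otherwise a, N, c would be a 231).
  avoids-separates : ∀ α {N γ a c} → Avoids231 (α ++ N ∷ γ) → a ∈ α → c ∈ γ → a < N → ¬ (c < a)
  avoids-separates (a ∷ α) {N} av (here refl) c∈ a<N c<a =
    avoids⇒¬Has231 (a ∷ α ++ N ∷ _) av (a , N , _ , first (SubPair-++ˡ α (first c∈)) , c<a , a<N)
  avoids-separates (w ∷ α) av (there a∈) c∈ a<N c<a =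
    avoids-separates α (avoids-suffix (w ∷ []) (α ++ _ ∷ _) av) a∈ c∈ a<N c<a

  avoids-glue : ∀ α {N γ} → Avoids231 α → Avoids231 γ →
    All (_< N) α → All (_< N) γ → (∀ {a c} → a ∈ α → c ∈ γ → a < c) →
    Avoids231 (α ++ N ∷ γ)
  avoids-glue [] {N} {γ} _ avγ _ γ<N _ = ¬Has231⇒avoids (N ∷ γ) noOccurrence
    where
      noOccurrence : ¬ Has231 (N ∷ γ)
      noOccurrence (x , y , z , first p , _ , x<y) = <-asym x<y (lookup γ<N (SubPair-head p))
      noOccurrence (x , y , z , later occ , lt)    = avoids⇒¬Has231 γ avγ (x , y , z , occ , lt)
  avoids-glue (w ∷ α) {N} {γ} avwα avγ (w<N ∷ α<N) γ<N α<γ =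
    ¬Has231⇒avoids (w ∷ α ++ N ∷ γ) noOccurrence
    where
      avRest : Avoids231 (α ++ N ∷ γ)
      avRest = avoids-glue α (avoids-suffix (w ∷ []) α avwα) avγ α<N γ<N (α<γ ∘ there)
      noOccurrence : ¬ Has231 (w ∷ α ++ N ∷ γ)
      noOccurrence (x , y , z , first p , z<x , x<y) with SubPair-split α p
      ... | inj₁ q           = avoids⇒¬Has231 (w ∷ α) avwα (x , y , z , first q , z<x , x<y)
      ... | inj₂ (here refl) = <-asym z<x w<N
      ... | inj₂ (there q)   = <-asym z<x (α<γ (here refl) q)
      noOccurrence (x , y , z , later occ , lt) = avoids⇒¬Has231 (α ++ N ∷ γ) avRest (x , y , z , occ , lt)

  module _ (p : ℕ) where

    SubPair-shift⁺ : ∀ {y z σ} → SubPair y z σ → SubPair (p + y) (p + z) (map (p +_) σ)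
    SubPair-shift⁺ (first z∈) = first (∈-map⁺ (p +_) z∈)
    SubPair-shift⁺ (later q)  = later (SubPair-shift⁺ q)

    SubTriple-shift⁺ : ∀ {x y z σ} → SubTriple x y z σ → SubTriple (p + x) (p + y) (p + z) (map (p +_) σ)
    SubTriple-shift⁺ (first q) = first (SubPair-shift⁺ q)
    SubTriple-shift⁺ (later q) = later (SubTriple-shift⁺ q)

    SubPair-shift⁻ : ∀ {y z} σ → SubPair y z (map (p +_) σ) →
      ∃ λ y′ → ∃ λ z′ → SubPair y′ z′ σ × y ≡ p + y′ × z ≡ p + z′
    SubPair-shift⁻ (w ∷ σ) (first q) with ∈-map⁻ (p +_) q
    ... | z′ , z′∈ , refl = w , z′ , first z′∈ , refl , refl
    SubPair-shift⁻ (w ∷ σ) (later q) with SubPair-shift⁻ σ q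
    ... | y′ , z′ , r , refl , refl = y′ , z′ , later r , refl , refl

    SubTriple-shift⁻ : ∀ {x y z} σ → SubTriple x y z (map (p +_) σ) →
      ∃ λ x′ → ∃ λ y′ → ∃ λ z′ → SubTriple x′ y′ z′ σ × x ≡ p + x′ × y ≡ p + y′ × z ≡ p + z′
    SubTriple-shift⁻ (w ∷ σ) (first q) with SubPair-shift⁻ σ q
    ... | y′ , z′ , r , refl , refl = w , y′ , z′ , first r , refl , refl , refl
    SubTriple-shift⁻ (w ∷ σ) (later q) with SubTriple-shift⁻ σ q
    ... | x′ , y′ , z′ , r , refl , refl , refl = x′ , y′ , z′ , later r , refl , refl , refl

    avoids-shift⁺ : ∀ σ → Avoids231 σ → Avoids231 (map (p +_) σ)
    avoids-shift⁺ σ av = ¬Has231⇒avoids (map (p +_) σ) noOccurrence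
      where
        noOccurrence : ¬ Has231 (map (p +_) σ)
        noOccurrence (x , y , z , occ , z<x , x<y) with SubTriple-shift⁻ σ occ
        ... | x′ , y′ , z′ , occ′ , refl , refl , refl =
          avoids⇒¬Has231 σ av (x′ , y′ , z′ , occ′ , +-cancelˡ-< p _ _ z<x , +-cancelˡ-< p _ _ x<y)

    avoids-shift⁻ : ∀ σ → Avoids231 (map (p +_) σ) → Avoids231 σ
    avoids-shift⁻ σ av = ¬Has231⇒avoids σ λ (x , y , z , occ , z<x , x<y) →
      avoids⇒¬Has231 (map (p +_) σ) av (p + x , p + y , p + z , SubTriple-shift⁺ occ , +-monoʳ-< p z<x , +-monoʳ-< p x<y)

module EqualityTests where

  open import Data.Nat using (zero; _≡ᵇ_)
  open import Data.Nat.Properties using (≡ᵇ⇒≡; ≡⇒≡ᵇ)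
  open import Data.Bool using (T; true; false)
  open import Data.Bool.Properties using (T-≡)
  open import Function using (Equivalence)
  open import Relation.Nullary using (contradiction)

  ≡ᵇ⇒≡′ : ∀ x y → (x ≡ᵇ y) ≡ true → x ≡ y
  ≡ᵇ⇒≡′ x y eq = ≡ᵇ⇒≡ x y (Equivalence.from T-≡ eq)

  ≢⇒≡ᵇ-false : ∀ x y → x ≢ y → (x ≡ᵇ y) ≡ false
  ≢⇒≡ᵇ-false x y x≢y with x ≡ᵇ y in eq
  ... | false = refl
  ... | true  = contradiction (≡ᵇ⇒≡′ x y eq) x≢y

  ≡ᵇ-false⇒≢ : ∀ x y → (x ≡ᵇ y) ≡ false → x ≢ y
  ≡ᵇ-false⇒≢ x .x eq refl = subst T eq (≡⇒≡ᵇ x x refl)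

  ≡ᵇ-refl : ∀ x → (x ≡ᵇ x) ≡ true
  ≡ᵇ-refl zero    = refl
  ≡ᵇ-refl (suc x) = ≡ᵇ-refl x

module Permutations where

  open EqualityTests
  open ListCounting using (Unique-concatMap; pigeonhole)
  open import Data.Nat using (zero; _<_; _≤_; _≡ᵇ_; z≤n; s≤s)
  open import Data.Nat.Properties using (suc-injective; ≤-reflexive; _≟_)
  open import Data.Bool using (true; false; not)
  open import Data.Bool.Properties using () renaming (_≟_ to _≟ᵇ_)
  open import Data.List using (List; []; _∷_; map; length; upTo)
  open import Data.List.Properties using (length-map; length-upTo; ∷-injective)
  open import Data.List.Membership.Propositional using (_∈_; find; lose)
  open import Data.List.Membership.Propositional.Properties
    using (∈-map⁺; ∈-map⁻; map∷⁻; ∈-upTo⁺; ∈-upTo⁻; ∈-concatMap⁺; ∈-concatMap⁻; ∈-filter⁺; ∈-filter⁻)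
  open import Data.List.Relation.Unary.Any using (here)
  open import Data.List.Relation.Unary.All using (All; []; _∷_; lookup)
  open import Data.List.Relation.Binary.Subset.Propositional using (_⊆_)
  open import Data.List.Relation.Unary.AllPairs using ([]; _∷_)
  open import Data.List.Relation.Unary.Unique.Propositional using (Unique)
  import Data.List.Relation.Unary.Unique.Propositional.Properties as Unique
  open import Data.Product using (_,_; proj₂)
  open import Function using (_∘_)
  open Pattern231 using (Avoids231)

  interval : ℕ → List ℕ
  interval n = map suc (upTo n)

  InInterval : ℕ → ℕ → Set
  InInterval n x = 0 < x × x ≤ n

  interval⁻ : ∀ {n x} → x ∈ interval n → InInterval n x
  interval⁻ x∈ with ∈-map⁻ suc x∈
  ... | i , i∈ , refl = s≤s z≤n , ∈-upTo⁻ i∈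

  interval⁺ : ∀ {n x} → InInterval n x → x ∈ interval n
  interval⁺ {x = suc x} (_ , x≤n) = ∈-map⁺ suc (∈-upTo⁺ x≤n)

  length-interval : ∀ n → length (interval n) ≡ n
  length-interval n = trans (length-map suc (upTo n)) (length-upTo n)

  Unique-interval : ∀ n → Unique (interval n)
  Unique-interval n = Unique.map⁺ suc-injective (Unique.upTo⁺ n)

  words⁻ : ∀ m n {w} → w ∈ words m n → length w ≡ n × All (InInterval m) w
  words⁻ m zero    (here refl) = refl , []
  words⁻ m (suc n) w∈ with find (∈-concatMap⁻ (λ v → map (v ∷_) (words m n)) {xs = interval m} w∈)
  ... | v , v∈ , vw∈ with map∷⁻ vw∈
  ... | w′ , w′∈ , refl with words⁻ m n w′∈
  ... | len , rng = cong suc len , interval⁻ v∈ ∷ rng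

  words⁺ : ∀ m n w → length w ≡ n → All (InInterval m) w → w ∈ words m n
  words⁺ m zero    []      _   _           = here refl
  words⁺ m (suc n) (v ∷ w) len (v∈ ∷ rng) =
    ∈-concatMap⁺ (λ v → map (v ∷_) (words m n))
      (lose (interval⁺ v∈) (∈-map⁺ (v ∷_) (words⁺ m n w (suc-injective len) rng)))

  Unique-words : ∀ m n → Unique (words m n)
  Unique-words m zero    = [] ∷ []
  Unique-words m (suc n) =
    Unique-concatMap (λ v → map (v ∷_) (words m n)) head (Unique-interval m)
      (λ _ → Unique.map⁺ (proj₂ ∘ ∷-injective) (Unique-words m n))
      (λ _ w∈ → head-of w∈)
    where
      head : List ℕ → ℕ
      head []      = 0
      head (v ∷ _) = v
      head-of : ∀ {v w} → w ∈ map (v ∷_) (words m n) → head w ≡ v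
      head-of w∈ with map∷⁻ w∈
      ... | _ , _ , refl = refl

  elem-false⁻ : ∀ x xs → elem x xs ≡ false → All (x ≢_) xs
  elem-false⁻ x []       _ = []
  elem-false⁻ x (y ∷ ys) e with x ≡ᵇ y in eq
  ... | false = ≡ᵇ-false⇒≢ x y eq ∷ elem-false⁻ x ys e

  elem-false⁺ : ∀ x xs → All (x ≢_) xs → elem x xs ≡ false
  elem-false⁺ x []       []           = refl
  elem-false⁺ x (y ∷ ys) (x≢y ∷ x∉ys) rewrite ≢⇒≡ᵇ-false x y x≢y = elem-false⁺ x ys x∉ys

  distinct⇒Unique : ∀ σ → distinct σ ≡ true → Unique σ
  distinct⇒Unique []       _ = []
  distinct⇒Unique (x ∷ xs) d with elem x xs in eq
  ... | false = elem-false⁻ x xs eq ∷ distinct⇒Unique xs d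

  Unique⇒distinct : ∀ σ → Unique σ → distinct σ ≡ true
  Unique⇒distinct []       []         = refl
  Unique⇒distinct (x ∷ xs) (x∉ ∷ uxs) rewrite elem-false⁺ x xs x∉ = Unique⇒distinct xs uxs

  record IsPerm231 (n : ℕ) (σ : List ℕ) : Set where
    constructor isPerm231
    field
      length≡ : length σ ≡ n
      inRange : All (InInterval n) σ
      unique  : Unique σ
      avoids  : Avoids231 σ

  perms231⁻ : ∀ n {σ} → σ ∈ perms231 n → IsPerm231 n σ
  perms231⁻ n {σ} σ∈ with ∈-filter⁻ (λ σ → not (contains231 σ) ≟ᵇ true) {xs = perms n} σ∈
  ... | σ∈perms , notContains with ∈-filter⁻ (λ σ → distinct σ ≟ᵇ true) {xs = words n n} σ∈perms
  ... | σ∈words , dist with words⁻ n n σ∈words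
  ... | len , rng = isPerm231 len rng (distinct⇒Unique σ dist) (not-true notContains)
    where
      not-true : ∀ {b} → not b ≡ true → b ≡ false
      not-true {false} _ = refl

  perms231⁺ : ∀ n {σ} → IsPerm231 n σ → σ ∈ perms231 n
  perms231⁺ n {σ} (isPerm231 len rng uσ av) =
    ∈-filter⁺ (λ σ → not (contains231 σ) ≟ᵇ true)
      (∈-filter⁺ (λ σ → distinct σ ≟ᵇ true) (words⁺ n n σ len rng) (Unique⇒distinct σ uσ))
      (cong not av)

  Unique-perms231 : ∀ n → Unique (perms231 n)
  Unique-perms231 n = Unique.filter⁺ _ (Unique.filter⁺ _ (Unique-words n n))

  perm-surjective : ∀ {n σ} → IsPerm231 n σ → interval n ⊆ σ
  perm-surjective {n} (isPerm231 len rng uσ _) =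
    pigeonhole _≟_ uσ (λ x∈ → interval⁺ (lookup rng x∈))
      (≤-reflexive (trans (length-interval n) (sym len)))

module Decomposition where

  open ListCounting using (Unique-length-≤; Unique-++⁻; Unique-concatMap)
  open EqualityTests using (≡ᵇ-refl; ≢⇒≡ᵇ-false)
  open Pattern231
  open Permutations
  open import Data.Nat using (_+_; _∸_; _<_; _≤_; _≡ᵇ_; _<?_; z≤n; s≤s)
  open import Data.Nat.Properties
  open import Data.Bool using (if_then_else_)
  open import Data.List using (List; []; _∷_; _++_; map; length; upTo; concatMap; take)
  open import Data.List.Properties using (length-++; length-map; ∷-injective; ++-assoc; ++-cancelˡ)
  open import Data.List.Membership.Propositional using (_∈_; find; lose)
  open import Data.List.Membership.Propositional.Properties
    using (∈-++⁻; ∈-∃++; ∈-map⁺; ∈-map⁻; ∈-upTo⁺; ∈-upTo⁻; ∈-concatMap⁺; ∈-concatMap⁻)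
  open import Data.List.Relation.Binary.Subset.Propositional using (_⊆_)
  open import Data.List.Relation.Unary.Any using (here; there)
  open import Data.List.Relation.Unary.All as All using (All; []; _∷_)
  import Data.List.Relation.Unary.All.Properties as AllP
  open import Data.List.Relation.Unary.AllPairs using (_∷_)
  import Data.List.Relation.Unary.AllPairs as AllPairs
  open import Data.List.Relation.Unary.Unique.Propositional using (Unique)
  import Data.List.Relation.Unary.Unique.Propositional.Properties as Unique
  open import Data.Product using (∃; _,_; proj₁; proj₂)
  open import Data.Sum using (inj₁; inj₂)
  open import Data.Empty using (⊥; ⊥-elim)
  open import Relation.Nullary using (yes; no)
  open import Function using (case_of_)

  glue : ℕ → ℕ → List ℕ → List ℕ → List ℕ
  glue N p α β = α ++ N ∷ map (p +_) β

  module Glue {n p α β} (p≤n : p ≤ n) (α-perm : IsPerm231 p α) (β-perm : IsPerm231 (n ∸ p) β) where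

    private
      N = suc n
      open IsPerm231 α-perm renaming (length≡ to α-length; inRange to α-range)
      open IsPerm231 β-perm renaming (length≡ to β-length; inRange to β-range)

    p+[n∸p]≡n : p + (n ∸ p) ≡ n
    p+[n∸p]≡n = m+[n∸m]≡n p≤n

    α<N : All (_< N) α
    α<N = All.map (λ (_ , a≤p) → s≤s (≤-trans a≤p p≤n)) α-range

    β-shifted : All (λ b → p < p + b × p + b < N) β
    β-shifted = All.map (λ (b>0 , b≤) →
        subst (_< p + _) (+-identityʳ p) (+-monoʳ-< p b>0)
      , s≤s (subst (p + _ ≤_) p+[n∸p]≡n (+-monoʳ-≤ p b≤))) β-range

    shifted-β : All (λ c → p < c × c < N) (map (p +_) β)
    shifted-β = AllP.map⁺ β-shifted

    glue-length : length (glue N p α β) ≡ N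
    glue-length = begin
      length (α ++ N ∷ map (p +_) β)        ≡⟨ length-++ α ⟩
      length α + suc (length (map (p +_) β)) ≡⟨ cong₂ (λ a b → a + suc b) α-length
                                                   (trans (length-map (p +_) β) β-length) ⟩
      p + suc (n ∸ p)                       ≡⟨ +-suc p (n ∸ p) ⟩
      suc (p + (n ∸ p))                     ≡⟨ cong suc p+[n∸p]≡n ⟩
      N                                     ∎
      where open ≡-Reasoning

    glue-range : All (InInterval N) (glue N p α β)
    glue-range = AllP.++⁺
      (All.map (λ (a>0 , a≤p) → a>0 , ≤-trans a≤p (≤-trans p≤n (n≤1+n n))) α-range)
      ((s≤s z≤n , ≤-refl) ∷ All.map (λ (p<c , c<N) → ≤-<-trans z≤n p<c , <⇒≤ c<N) shifted-β)

    glue-unique : Unique (glue N p α β)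
    glue-unique = Unique.++⁺ (IsPerm231.unique α-perm)
      (All.map (λ (_ , c<N) c≡N → <-irrefl (sym c≡N) c<N) shifted-β
        ∷ Unique.map⁺ (+-cancelˡ-≡ p _ _) (IsPerm231.unique β-perm))
      λ (a∈α , a∈rest) → disjoint a∈α a∈rest
      where
        disjoint : ∀ {a} → a ∈ α → a ∈ N ∷ map (p +_) β → ⊥
        disjoint a∈α (here refl) = <-irrefl refl (All.lookup α<N a∈α)
        disjoint a∈α (there a∈β) =
          <-irrefl refl (≤-<-trans (proj₂ (All.lookup α-range a∈α)) (proj₁ (All.lookup shifted-β a∈β)))

    glue-avoids : Avoids231 (glue N p α β)
    glue-avoids = avoids-glue α (IsPerm231.avoids α-perm) (avoids-shift⁺ p β (IsPerm231.avoids β-perm))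
      α<N (All.map proj₂ shifted-β)
      λ a∈α c∈ → ≤-<-trans (proj₂ (All.lookup α-range a∈α)) (proj₁ (All.lookup shifted-β c∈))

    glue-isPerm231 : IsPerm231 N (glue N p α β)
    glue-isPerm231 = isPerm231 glue-length glue-range glue-unique glue-avoids

  module Split {n α γ} (σ-perm : IsPerm231 (suc n) (α ++ suc n ∷ γ)) where

    private
      N = suc n
      open IsPerm231 σ-perm renaming (length≡ to σ-length; inRange to σ-range; unique to σ-unique; avoids to σ-avoids)

    p : ℕ
    p = length α

    private
      α-unique = proj₁ (Unique-++⁻ α σ-unique)
      Nγ-unique = proj₁ (proj₂ (Unique-++⁻ α σ-unique))
      α∩Nγ = proj₂ (proj₂ (Unique-++⁻ α σ-unique))
      α-range = AllP.++⁻ˡ α σ-range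
      γ-range = All.tail (AllP.++⁻ʳ α σ-range)

    α<N : All (_< N) α
    α<N = All.tabulate λ a∈ → ≤∧≢⇒< (proj₂ (All.lookup α-range a∈)) λ a≡N → α∩Nγ a∈ (here a≡N)

    -- Every value up to an entry a of α lies in α: it is not N, and it cannot
    -- lie in γ by the separation property; hence a ≤ |α|.
    α-bounded : All (_≤ p) α
    α-bounded = All.tabulate λ {a} a∈ →
      subst (_≤ p) (length-interval a) (Unique-length-≤ (Unique-interval a) (below-a-in-α a∈))
      where
        below-a-in-α : ∀ {a} → a ∈ α → interval a ⊆ α
        below-a-in-α {a} a∈ v∈ with interval⁻ v∈
        ... | v>0 , v≤a with ∈-++⁻ α (perm-surjective σ-perm (interval⁺ (v>0 , ≤-trans v≤a (<⇒≤ (All.lookup α<N a∈)))))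
        ... | inj₁ v∈α         = v∈α
        ... | inj₂ (here refl) = ⊥-elim (<-irrefl refl (≤-<-trans v≤a (All.lookup α<N a∈)))
        ... | inj₂ (there v∈γ) with m≤n⇒m<n∨m≡n v≤a
        ... | inj₁ v<a  = ⊥-elim (avoids-separates α σ-avoids a∈ v∈γ (All.lookup α<N a∈) v<a)
        ... | inj₂ refl = ⊥-elim (α∩Nγ a∈ (there v∈γ))

    α-perm : IsPerm231 p α
    α-perm = isPerm231 refl
      (All.zipWith (λ ((a>0 , _) , a≤p) → a>0 , a≤p) (α-range , α-bounded))
      α-unique (avoids-prefix α (N ∷ γ) σ-avoids)

    -- As α is all of [1..p], the entries of γ exceed p.
    γ>p : All (p <_) γ
    γ>p = All.tabulate λ {c} c∈ → case p <? c of λ where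
      (yes p<c) → p<c
      (no  p≮c) → ⊥-elim (α∩Nγ (perm-surjective α-perm (interval⁺ (proj₁ (All.lookup γ-range c∈) , ≮⇒≥ p≮c))) (there c∈))

    γ≤n : All (_≤ n) γ
    γ≤n = All.tabulate λ c∈ →
      ≤-pred (≤∧≢⇒< (proj₂ (All.lookup γ-range c∈)) λ c≡N → All.lookup (AllPairs.head Nγ-unique) c∈ (sym c≡N))

    p+|γ|≡n : p + length γ ≡ n
    p+|γ|≡n = suc-injective (begin
      suc (p + length γ)   ≡⟨ +-suc p (length γ) ⟨
      p + suc (length γ)   ≡⟨ length-++ α ⟨
      length (α ++ N ∷ γ)  ≡⟨ σ-length ⟩
      N                    ∎)
      where open ≡-Reasoning

    p≤n : p ≤ n
    p≤n = subst (p ≤_) p+|γ|≡n (m≤m+n p (length γ))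

    β : List ℕ
    β = map (_∸ p) γ

    shift-β : map (p +_) β ≡ γ
    shift-β = unshift γ γ>p
      where
        unshift : ∀ cs → All (p <_) cs → map (p +_) (map (_∸ p) cs) ≡ cs
        unshift []       []          = refl
        unshift (c ∷ cs) (p<c ∷ p<cs) = cong₂ _∷_ (m+[n∸m]≡n (<⇒≤ p<c)) (unshift cs p<cs)

    β-perm : IsPerm231 (n ∸ p) β
    β-perm = isPerm231
      (trans (length-map (_∸ p) γ) (trans (sym (m+n∸m≡n p (length γ))) (cong (_∸ p) p+|γ|≡n)))
      (AllP.map⁺ (All.zipWith (λ (p<c , c≤n) → m<n⇒0<n∸m p<c , ∸-monoˡ-≤ p c≤n) (γ>p , γ≤n)))
      (Unique.map⁻ (subst Unique (sym shift-β) (AllPairs.tail Nγ-unique)))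
      (avoids-shift⁻ p β (subst Avoids231 (sym shift-β) γ-avoids))
      where
        γ-avoids : Avoids231 γ
        γ-avoids = avoids-suffix (α ++ N ∷ []) γ (subst Avoids231 (sym (++-assoc α (N ∷ []) γ)) σ-avoids)

  decompose : ∀ n {σ} → IsPerm231 (suc n) σ → ∃ λ p → ∃ λ α → ∃ λ β →
    p ≤ n × IsPerm231 p α × IsPerm231 (n ∸ p) β × σ ≡ glue (suc n) p α β
  decompose n σ-perm with ∈-∃++ (perm-surjective σ-perm (interval⁺ (s≤s z≤n , ≤-refl)))
  ... | α , γ , refl = p , α , β , p≤n , α-perm , β-perm , cong (λ z → α ++ suc n ∷ z) (sym shift-β)
    where open Split σ-perm

  glued : ℕ → List (List ℕ)
  glued n = concatMap (λ p → concatMap (λ α → map (glue (suc n) p α) (perms231 (n ∸ p))) (perms231 p))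
                      (upTo (suc n))

  perms231⊆glued : ∀ n → perms231 (suc n) ⊆ glued n
  perms231⊆glued n σ∈ with decompose n (perms231⁻ (suc n) σ∈)
  ... | p , α , β , p≤n , α-perm , β-perm , refl =
    ∈-concatMap⁺ _ (lose (∈-upTo⁺ (s≤s p≤n))
      (∈-concatMap⁺ _ (lose (perms231⁺ p α-perm) (∈-map⁺ (glue (suc n) p α) (perms231⁺ (n ∸ p) β-perm)))))

  glued⊆perms231 : ∀ n → glued n ⊆ perms231 (suc n)
  glued⊆perms231 n σ∈ with find (∈-concatMap⁻ _ {xs = upTo (suc n)} σ∈)
  ... | p , p∈ , σ∈p with find (∈-concatMap⁻ _ {xs = perms231 p} σ∈p)
  ... | α , α∈ , σ∈α with ∈-map⁻ (glue (suc n) p α) σ∈α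
  ... | β , β∈ , refl = perms231⁺ (suc n)
    (Glue.glue-isPerm231 (≤-pred (∈-upTo⁻ p∈)) (perms231⁻ p α∈) (perms231⁻ (n ∸ p) β∈))

  positionOf : ℕ → List ℕ → ℕ
  positionOf N []       = 0
  positionOf N (x ∷ xs) = if x ≡ᵇ N then 0 else suc (positionOf N xs)

  positionOf-glue : ∀ N α rest → All (_< N) α → positionOf N (α ++ N ∷ rest) ≡ length α
  positionOf-glue N []      rest []          rewrite ≡ᵇ-refl N = refl
  positionOf-glue N (x ∷ α) rest (x<N ∷ α<N) rewrite ≢⇒≡ᵇ-false x N (<⇒≢ x<N) =
    cong suc (positionOf-glue N α rest α<N)

  take-++ : ∀ (α : List ℕ) ys → take (length α) (α ++ ys) ≡ α
  take-++ []      ys = refl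
  take-++ (x ∷ α) ys = cong (x ∷_) (take-++ α ys)

  -- Different (p, α, β) give different words: p is the position of the
  -- maximum, α the prefix of length p, and β is recovered from the suffix.
  Unique-glued : ∀ n → Unique (glued n)
  Unique-glued n = Unique-concatMap _ (positionOf N) (Unique.upTo⁺ N) blocks-unique position
    where
      N = suc n

      glue-injective : ∀ {p α β β′} → glue N p α β ≡ glue N p α β′ → β ≡ β′
      glue-injective {p} eq = map-injective (proj₂ (∷-injective (++-cancelˡ _ _ _ eq)))
        where
          map-injective : ∀ {xs ys} → map (p +_) xs ≡ map (p +_) ys → xs ≡ ys
          map-injective {[]}     {[]}     _  = refl
          map-injective {x ∷ xs} {y ∷ ys} eq with ∷-injective eq
          ... | x≡y , xs≡ys = cong₂ _∷_ (+-cancelˡ-≡ p _ _ x≡y) (map-injective xs≡ys)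

      blocks-unique : ∀ {p} → p ∈ upTo N →
        Unique (concatMap (λ α → map (glue N p α) (perms231 (n ∸ p))) (perms231 p))
      blocks-unique {p} _ = Unique-concatMap _ (take p) (Unique-perms231 p)
        (λ _ → Unique.map⁺ glue-injective (Unique-perms231 (n ∸ p)))
        prefix
        where
          prefix : ∀ {α y} → α ∈ perms231 p → y ∈ map (glue N p α) (perms231 (n ∸ p)) → take p y ≡ α
          prefix {α} α∈ y∈ with ∈-map⁻ (glue N p α) y∈
          ... | β , _ , refl =
            subst (λ k → take k (glue N p α β) ≡ α) (IsPerm231.length≡ (perms231⁻ p α∈)) (take-++ α _)

      position : ∀ {p y} → p ∈ upTo N →
        y ∈ concatMap (λ α → map (glue N p α) (perms231 (n ∸ p))) (perms231 p) → positionOf N y ≡ p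
      position {p} p∈ y∈ with find (∈-concatMap⁻ _ {xs = perms231 p} y∈)
      ... | α , α∈ , y∈α with ∈-map⁻ (glue N p α) y∈α
      ... | β , β∈ , refl =
        let α-perm = perms231⁻ p α∈ in
        trans (positionOf-glue N α _ (Glue.α<N (≤-pred (∈-upTo⁻ p∈)) α-perm (perms231⁻ (n ∸ p) β∈)))
              (IsPerm231.length≡ α-perm)

module Statistics where

  open import Data.Nat using (zero; _+_; _∸_; _⊔_; _<_; _≤_; _≤ᵇ_; _<ᵇ_; s≤s)
  open import Data.Nat.Properties
    using (⊔-assoc; +-suc; +-comm; +-assoc; +-identityʳ; [m+n]∸[m+o]≡n∸o; m≤n⇒m∸n≡0)
  open ListCounting using (indicator)
  open import Data.Bool using (true; false; _∧_)
  open import Data.Bool.Properties using (∧-identityʳ; ∧-zeroʳ)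
  open import Data.List using (List; []; _∷_; _++_; map; length)
  open import Data.List.Membership.Propositional using (_∈_)
  open import Data.List.Relation.Unary.Any using (here; there)
  open import Data.List.Relation.Unary.All using (All; []; _∷_)

  maxdrop′ : List ℕ → ℕ
  maxdrop′ = maxdropFrom 2

  -- des' : descents of n+1 followed by β, i.e. one more than des β when β ≠ []
  des′ : List ℕ → ℕ
  des′ []       = 0
  des′ (x ∷ xs) = suc (des (x ∷ xs))

  suc-≤ᵇ : ∀ m n → (suc m ≤ᵇ suc n) ≡ (m ≤ᵇ n)
  suc-≤ᵇ zero    n = refl
  suc-≤ᵇ (suc m) n = refl

  ⊔-≤ᵇ : ∀ a b k → (a ⊔ b ≤ᵇ k) ≡ (a ≤ᵇ k) ∧ (b ≤ᵇ k)
  ⊔-≤ᵇ zero    b       k       = refl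
  ⊔-≤ᵇ (suc a) zero    k       = sym (∧-identityʳ _)
  ⊔-≤ᵇ (suc a) (suc b) zero    = refl
  ⊔-≤ᵇ (suc a) (suc b) (suc k)
    rewrite suc-≤ᵇ (a ⊔ b) k | suc-≤ᵇ a k | suc-≤ᵇ b k = ⊔-≤ᵇ a b k

  maxdropFrom-++ : ∀ i xs ys →
    maxdropFrom i (xs ++ ys) ≡ maxdropFrom i xs ⊔ maxdropFrom (i + length xs) ys
  maxdropFrom-++ i []       ys = cong (λ j → maxdropFrom j ys) (sym (+-identityʳ i))
  maxdropFrom-++ i (x ∷ xs) ys = begin
    (i ∸ x) ⊔ maxdropFrom (suc i) (xs ++ ys)
      ≡⟨ cong ((i ∸ x) ⊔_) (maxdropFrom-++ (suc i) xs ys) ⟩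
    (i ∸ x) ⊔ (maxdropFrom (suc i) xs ⊔ maxdropFrom (suc i + length xs) ys)
      ≡⟨ ⊔-assoc (i ∸ x) _ _ ⟨
    (i ∸ x) ⊔ maxdropFrom (suc i) xs ⊔ maxdropFrom (suc i + length xs) ys
      ≡⟨ cong (λ j → (i ∸ x) ⊔ maxdropFrom (suc i) xs ⊔ maxdropFrom j ys) (+-suc i (length xs)) ⟨
    (i ∸ x) ⊔ maxdropFrom (suc i) xs ⊔ maxdropFrom (i + suc (length xs)) ys ∎
    where open ≡-Reasoning

  maxdropFrom-shift : ∀ p i xs → maxdropFrom (p + i) (map (p +_) xs) ≡ maxdropFrom i xs
  maxdropFrom-shift p i []       = refl
  maxdropFrom-shift p i (x ∷ xs) =
    cong₂ _⊔_ ([m+n]∸[m+o]≡n∸o p i x)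
      (trans (cong (λ j → maxdropFrom j (map (p +_) xs)) (sym (+-suc p i))) (maxdropFrom-shift p (suc i) xs))

  -- maxdrop (α N (β+p)) = max (maxdrop α) (maxdrop' β) when |α| = p < N:
  -- the entry N itself has no drop.
  maxdrop-glue : ∀ N p α β → length α ≡ p → p < N →
    maxdrop (α ++ N ∷ map (p +_) β) ≡ maxdrop α ⊔ maxdrop′ β
  maxdrop-glue N p α β refl p<N = begin
    maxdrop (α ++ N ∷ map (p +_) β)
      ≡⟨ maxdropFrom-++ 1 α (N ∷ map (p +_) β) ⟩
    maxdrop α ⊔ ((suc p ∸ N) ⊔ maxdropFrom (suc (suc p)) (map (p +_) β))
      ≡⟨ cong (λ d → maxdrop α ⊔ (d ⊔ maxdropFrom (suc (suc p)) (map (p +_) β))) (m≤n⇒m∸n≡0 p<N) ⟩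
    maxdrop α ⊔ maxdropFrom (suc (suc p)) (map (p +_) β)
      ≡⟨ cong (λ j → maxdrop α ⊔ maxdropFrom j (map (p +_) β)) (+-comm 2 p) ⟩
    maxdrop α ⊔ maxdropFrom (p + 2) (map (p +_) β)
      ≡⟨ cong (maxdrop α ⊔_) (maxdropFrom-shift p 2 β) ⟩
    maxdrop α ⊔ maxdrop′ β ∎
    where open ≡-Reasoning

  -- Moving one position right raises every drop by one, so bounds shift by one.
  ∸-suc-≤ᵇ : ∀ i x k → (suc i ∸ x ≤ᵇ suc k) ≡ (i ∸ x ≤ᵇ k)
  ∸-suc-≤ᵇ i       zero          k = suc-≤ᵇ i k
  ∸-suc-≤ᵇ zero    (suc zero)    k = refl
  ∸-suc-≤ᵇ zero    (suc (suc x)) k = refl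
  ∸-suc-≤ᵇ (suc i) (suc x)       k = ∸-suc-≤ᵇ i x k

  maxdropFrom-suc-≤ᵇ : ∀ i xs k → (maxdropFrom (suc i) xs ≤ᵇ suc k) ≡ (maxdropFrom i xs ≤ᵇ k)
  maxdropFrom-suc-≤ᵇ i []       k = refl
  maxdropFrom-suc-≤ᵇ i (x ∷ xs) k
    rewrite ⊔-≤ᵇ (suc i ∸ x) (maxdropFrom (suc (suc i)) xs) (suc k)
          | ⊔-≤ᵇ (i ∸ x) (maxdropFrom (suc i) xs) k
          | ∸-suc-≤ᵇ i x k | maxdropFrom-suc-≤ᵇ (suc i) xs k = refl

  maxdropFrom-has-drop : ∀ s xs → 1 ∈ xs → (maxdropFrom (suc (suc s)) xs ≤ᵇ 0) ≡ false
  maxdropFrom-has-drop s (x ∷ xs) (here refl)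
    rewrite ⊔-≤ᵇ (suc s) (maxdropFrom (suc (suc (suc s))) xs) 0 = refl
  maxdropFrom-has-drop s (x ∷ xs) (there 1∈)
    rewrite ⊔-≤ᵇ (suc (suc s) ∸ x) (maxdropFrom (suc (suc (suc s))) xs) 0
          | maxdropFrom-has-drop (suc s) xs 1∈ = ∧-zeroʳ _

  private
    <ᵇ-shift : ∀ p a b → (p + a <ᵇ p + b) ≡ (a <ᵇ b)
    <ᵇ-shift zero    a b = refl
    <ᵇ-shift (suc p) a b = <ᵇ-shift p a b

    <⇒<ᵇ≡true : ∀ {a b} → a < b → (a <ᵇ b) ≡ true
    <⇒<ᵇ≡true {zero}  {suc b} _         = refl
    <⇒<ᵇ≡true {suc a} {suc b} (s≤s a<b) = <⇒<ᵇ≡true a<b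

    <⇒>ᵇ≡false : ∀ {a b} → a < b → (b <ᵇ a) ≡ false
    <⇒>ᵇ≡false {zero}  {suc b} _         = refl
    <⇒>ᵇ≡false {suc a} {suc b} (s≤s a<b) = <⇒>ᵇ≡false a<b

  des-shift : ∀ p xs → des (map (p +_) xs) ≡ des xs
  des-shift p []           = refl
  des-shift p (x ∷ [])     = refl
  des-shift p (x ∷ y ∷ xs) =
    cong₂ (λ b d → indicator b + d) (<ᵇ-shift p y x) (des-shift p (y ∷ xs))

  -- An ascent into a larger entry y adds no descent.
  des-++ : ∀ xs y ys → All (_< y) xs → des (xs ++ y ∷ ys) ≡ des xs + des (y ∷ ys)
  des-++ []           y ys _           = refl
  des-++ (x ∷ [])     y ys (x<y ∷ _)   rewrite <⇒>ᵇ≡false x<y = refl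
  des-++ (x ∷ x′ ∷ xs) y ys (_ ∷ xs<y) =
    trans (cong (indicator (x′ <ᵇ x) +_) (des-++ (x′ ∷ xs) y ys xs<y))
          (sym (+-assoc (indicator (x′ <ᵇ x)) _ _))

  des-after-max : ∀ N p β → All (λ b → p + b < N) β → des (N ∷ map (p +_) β) ≡ des′ β
  des-after-max N p []      _         = refl
  des-after-max N p (b ∷ β) (b<N ∷ _) rewrite <⇒<ᵇ≡true b<N = cong suc (des-shift p (b ∷ β))

  des-glue : ∀ N p α β → All (_< N) α → All (λ b → p + b < N) β →
    des (α ++ N ∷ map (p +_) β) ≡ des α + des′ β
  des-glue N p α β α<N β<N =
    trans (des-++ α N (map (p +_) β) α<N) (cong (des α +_) (des-after-max N p β β<N))

module Recurrence where

  open ListCounting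
  open EqualityTests using (≡ᵇ-refl; ≢⇒≡ᵇ-false)
  open Permutations using (IsPerm231; perms231⁻; Unique-perms231)
  open Decomposition
  open Statistics
  open import Data.Nat using (zero; _+_; _*_; _∸_; _<_; _≤_; _≤?_; _≡ᵇ_; _≤ᵇ_; s≤s)
  open import Data.Nat.Properties
    using (+-0-isCommutativeMonoid; +-identityʳ; *-distribʳ-+; ≤-pred; ≰⇒>)
  open import Data.Nat.ListAction using (sum)
  open import Data.Bool using (Bool; true; false; _∧_)
  open import Data.Bool.Properties using (∧-assoc; ∧-zeroʳ)
  open import Data.List using (List; []; _∷_; map; upTo; concatMap)
  open import Data.List.Membership.Propositional using (_∈_)
  open import Data.List.Membership.Propositional.Properties using (∈-upTo⁻)
  open import Data.List.Properties using (map-cong-local)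
  open import Data.List.Relation.Unary.All as All using (All)
  open import Relation.Nullary using (Dec; yes; no)
  open import Data.Product using (_,_; proj₂)
  open import Function using (_∘_)
  open FiniteSums +-0-isCommutativeMonoid

  counted : ℕ → ℕ → List ℕ → Bool
  counted k d σ = (maxdrop σ ≤ᵇ k) ∧ (des σ ≡ᵇ d)

  a : ℕ → ℕ → ℕ → ℕ
  a k n d = count (counted k d) (perms231 n)

  countedFactor : ℕ → ℕ → List ℕ → Bool
  countedFactor k e β = (maxdrop′ β ≤ᵇ k) ∧ (des′ β ≡ᵇ e)

  e : ℕ → ℕ → ℕ → ℕ
  e k m j = count (countedFactor k j) (perms231 m)

  counted-glue : ∀ k d {n p α β} → p ≤ n → IsPerm231 p α → IsPerm231 (n ∸ p) β →
    counted k d (glue (suc n) p α β) ≡ (maxdrop α ≤ᵇ k) ∧ ((maxdrop′ β ≤ᵇ k) ∧ (des α + des′ β ≡ᵇ d))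
  counted-glue k d {n} {p} {α} {β} p≤n α-perm β-perm
    rewrite maxdrop-glue (suc n) p α β (IsPerm231.length≡ α-perm) (s≤s p≤n)
          | ⊔-≤ᵇ (maxdrop α) (maxdrop′ β) k
          | des-glue (suc n) p α β (Glue.α<N p≤n α-perm β-perm)
                                   (All.map proj₂ (Glue.β-shifted p≤n α-perm β-perm))
    = ∧-assoc (maxdrop α ≤ᵇ k) _ _

  private
    +-≡ᵇ : ∀ a u d → a ≤ d → (a + u ≡ᵇ d) ≡ (u ≡ᵇ d ∸ a)
    +-≡ᵇ zero    u d       _         = refl
    +-≡ᵇ (suc a) u (suc d) (s≤s a≤d) = +-≡ᵇ a u d a≤d

    +-≡ᵇ-false : ∀ a u d → d < a → (a + u ≡ᵇ d) ≡ false
    +-≡ᵇ-false (suc a) u zero    _         = refl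
    +-≡ᵇ-false (suc a) u (suc d) (s≤s d<a) = +-≡ᵇ-false a u d d<a

  -- Counting solutions of a + v x = d by the split d = j + (d - j), j = a.
  count-by-offset : ∀ {A : Set} (R : A → Bool) (v : A → ℕ) a d xs →
    count (λ x → R x ∧ (a + v x ≡ᵇ d)) xs ≡
    sum< (suc d) (λ j → indicator (a ≡ᵇ j) * count (λ x → R x ∧ (v x ≡ᵇ d ∸ j)) xs)
  count-by-offset R v a d xs = by-cases (a ≤? d)
    where
      countAt : ℕ → ℕ
      countAt j = count (λ x → R x ∧ (v x ≡ᵇ d ∸ j)) xs

      term : ℕ → ℕ
      term j = indicator (a ≡ᵇ j) * countAt j

      by-cases : Dec (a ≤ d) → count (λ x → R x ∧ (a + v x ≡ᵇ d)) xs ≡ sum< (suc d) term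
      by-cases (yes a≤d) = begin
        count (λ x → R x ∧ (a + v x ≡ᵇ d)) xs
          ≡⟨ count-cong _ _ xs (λ {x} _ → cong (R x ∧_) (+-≡ᵇ a (v x) d a≤d)) ⟩
        countAt a
          ≡⟨ +-identityʳ (countAt a) ⟨
        indicator true * countAt a
          ≡⟨ cong (λ b → indicator b * countAt a) (≡ᵇ-refl a) ⟨
        term a
          ≡⟨ sum<-single (suc d) term a (s≤s a≤d) (λ j _ j≢a →
               cong (λ b → indicator b * countAt j) (≢⇒≡ᵇ-false a j (j≢a ∘ sym))) ⟨
        sum< (suc d) term ∎
        where open ≡-Reasoning
      by-cases (no a≰d) = trans
        (count-none _ xs λ {x} _ → trans (cong (R x ∧_) (+-≡ᵇ-false a (v x) d (≰⇒> a≰d))) (∧-zeroʳ (R x)))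
        (sym (sum<-zero (suc d) term λ j j≤d →
          cong (λ b → indicator b * countAt j) (≢⇒≡ᵇ-false a j λ { refl → a≰d (≤-pred j≤d) })))

  sum-indicator : ∀ {A : Set} (P : A → Bool) X xs →
    sum (map (λ x → indicator (P x) * X) xs) ≡ count P xs * X
  sum-indicator P X []       = refl
  sum-indicator P X (x ∷ xs) =
    trans (cong (indicator (P x) * X +_) (sum-indicator P X xs)) (sym (*-distribʳ-+ X (indicator (P x)) (count P xs)))

  count-over-suffixes : ∀ k d {n p α} → p ≤ n → IsPerm231 p α →
    count (counted k d) (map (glue (suc n) p α) (perms231 (n ∸ p)))
      ≡ sum< (suc d) (λ j → indicator (counted k j α) * e k (n ∸ p) (d ∸ j))
  count-over-suffixes k d {n} {p} {α} p≤n α-perm = begin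
    count (counted k d) (map (glue (suc n) p α) βs)
      ≡⟨ count-map (counted k d) (glue (suc n) p α) βs ⟩
    count (λ β → counted k d (glue (suc n) p α β)) βs
      ≡⟨ count-cong _ _ βs (λ β∈ → counted-glue k d p≤n α-perm (perms231⁻ (n ∸ p) β∈)) ⟩
    count (λ β → (maxdrop α ≤ᵇ k) ∧ ((maxdrop′ β ≤ᵇ k) ∧ (des α + des′ β ≡ᵇ d))) βs
      ≡⟨ by-prefix-test (maxdrop α ≤ᵇ k) ⟩
    sum< (suc d) (λ j → indicator (counted k j α) * e k (n ∸ p) (d ∸ j)) ∎
    where
      open ≡-Reasoning
      βs = perms231 (n ∸ p)
      by-prefix-test : ∀ b →
        count (λ β → b ∧ ((maxdrop′ β ≤ᵇ k) ∧ (des α + des′ β ≡ᵇ d))) βs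
          ≡ sum< (suc d) (λ j → indicator (b ∧ (des α ≡ᵇ j)) * e k (n ∸ p) (d ∸ j))
      by-prefix-test false = trans (count-none _ βs λ _ → refl) (sym (sum<-zero (suc d) _ λ _ _ → refl))
      by-prefix-test true  = count-by-offset (λ β → maxdrop′ β ≤ᵇ k) des′ (des α) d βs

  count-over-block : ∀ k d {n p} → p ≤ n →
    count (counted k d) (concatMap (λ α → map (glue (suc n) p α) (perms231 (n ∸ p))) (perms231 p))
      ≡ sum< (suc d) (λ j → a k p j * e k (n ∸ p) (d ∸ j))
  count-over-block k d {n} {p} p≤n = begin
    count (counted k d) (concatMap (λ α → map (glue (suc n) p α) (perms231 (n ∸ p))) αs)
      ≡⟨ count-concatMap (counted k d) (λ α → map (glue (suc n) p α) (perms231 (n ∸ p))) αs ⟩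
    sum (map (λ α → count (counted k d) (map (glue (suc n) p α) (perms231 (n ∸ p)))) αs)
      ≡⟨ cong sum (map-cong-local (All.tabulate λ α∈ → count-over-suffixes k d p≤n (perms231⁻ p α∈))) ⟩
    sum (map (λ α → sum< (suc d) (λ j → indicator (counted k j α) * e k (n ∸ p) (d ∸ j))) αs)
      ≡⟨ foldr-sum<-interchange αs (suc d) (λ α j → indicator (counted k j α) * e k (n ∸ p) (d ∸ j)) ⟩
    sum< (suc d) (λ j → sum (map (λ α → indicator (counted k j α) * e k (n ∸ p) (d ∸ j)) αs))
      ≡⟨ sum<-cong (suc d) _ _ (λ j _ → sum-indicator (counted k j) (e k (n ∸ p) (d ∸ j)) αs) ⟩
    sum< (suc d) (λ j → a k p j * e k (n ∸ p) (d ∸ j)) ∎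
    where
      open ≡-Reasoning
      αs = perms231 p

  a-recurrence : ∀ k n d →
    a k (suc n) d ≡ sum< (suc n) (λ p → sum< (suc d) (λ j → a k p j * e k (n ∸ p) (d ∸ j)))
  a-recurrence k n d = begin
    count (counted k d) (perms231 (suc n))
      ≡⟨ count-same-elements (counted k d) (Unique-perms231 (suc n)) (Unique-glued n)
                             (perms231⊆glued n) (glued⊆perms231 n) ⟩
    count (counted k d) (glued n)
      ≡⟨ count-concatMap (counted k d) (λ p → concatMap (λ α → map (glue (suc n) p α) (perms231 (n ∸ p))) (perms231 p)) (upTo (suc n)) ⟩
    sum (map (λ p → count (counted k d) (concatMap (λ α → map (glue (suc n) p α) (perms231 (n ∸ p))) (perms231 p)))
             (upTo (suc n)))
      ≡⟨ cong sum (map-cong-local (All.tabulate {xs = upTo (suc n)} λ p∈ →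
           count-over-block k d (≤-pred (∈-upTo⁻ p∈)))) ⟩
    sum (map (λ p → sum< (suc d) (λ j → a k p j * e k (n ∸ p) (d ∸ j))) (upTo (suc n)))
      ≡⟨ foldr-applyUpTo (λ p → sum< (suc d) (λ j → a k p j * e k (n ∸ p) (d ∸ j))) (λ p → p) (suc n) ⟩
    sum< (suc n) (λ p → sum< (suc d) (λ j → a k p j * e k (n ∸ p) (d ∸ j))) ∎
    where open ≡-Reasoning

module Series where

  open EqualityTests using (≢⇒≡ᵇ-false)
  open import Data.Nat as ℕ using (zero; _∸_; _<_; _≤_; _≡ᵇ_; z≤n; s≤s)
  open import Data.Nat.Properties as ℕ using (≤-pred; ≤-refl; n∸n≡0; m<n⇒0<n∸m; +-∸-assoc; ≤∧≢⇒<)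
  open import Data.Integer using (ℤ; +_; -_; _+_; _*_)
  open import Data.Integer.Properties as ℤ
    using (+-0-isCommutativeMonoid; *-zeroʳ; *-identityʳ; *-identityˡ; *-distribˡ-+; neg-distribʳ-*;
           neg-distrib-+; +-identityʳ; +-inverseʳ; pos-+)
  open import Data.Bool using (false; _∧_; if_then_else_)
  open import Data.Bool.Properties using (∧-zeroʳ)
  open import Function using (_∘_; id)
  open FiniteSums +-0-isCommutativeMonoid public

  tShift : FPS → FPS
  tShift F zero    d = + 0
  tShift F (suc n) d = F n d

  txShift : FPS → FPS
  txShift F (suc n) (suc d) = F n d
  txShift F _       _       = + 0

  sumTo-sum< : ∀ n h → sumTo n h ≡ sum< (suc n) h
  sumTo-sum< n h = foldr-applyUpTo h id (suc n)

  ⊛-sum< : ∀ F G n d → (F ⊛ G) n d ≡ sum< (suc n) (λ i → sum< (suc d) (λ j → F i j * G (n ∸ i) (d ∸ j)))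
  ⊛-sum< F G n d = trans (sumTo-sum< n (λ i → sumTo d (term i)))
                          (sum<-cong (suc n) _ _ λ i _ → sumTo-sum< d (term i))
    where
      term : ℕ → ℕ → ℤ
      term i j = F i j * G (n ∸ i) (d ∸ j)

  ⊛-congʳ : ∀ F {G G′} → G ≈ G′ → F ⊛ G ≈ F ⊛ G′
  ⊛-congʳ F {G} {G′} G≈G′ n d = begin
    (F ⊛ G) n d
      ≡⟨ ⊛-sum< F G n d ⟩
    sum< (suc n) (λ i → sum< (suc d) (λ j → F i j * G (n ∸ i) (d ∸ j)))
      ≡⟨ sum<-cong (suc n) _ _ (λ i _ → sum<-cong (suc d) _ _ λ j _ → cong (F i j *_) (G≈G′ (n ∸ i) (d ∸ j))) ⟩
    sum< (suc n) (λ i → sum< (suc d) (λ j → F i j * G′ (n ∸ i) (d ∸ j)))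
      ≡⟨ ⊛-sum< F G′ n d ⟨
    (F ⊛ G′) n d  ∎
    where open ≡-Reasoning

  sum<-neg : ∀ m g → sum< m (λ i → - g i) ≡ - sum< m g
  sum<-neg zero    g = refl
  sum<-neg (suc m) g = trans (cong (λ s → - g 0 + s) (sum<-neg m (g ∘ suc))) (sym (neg-distrib-+ (g 0) _))

  sum<-− : ∀ m g h → sum< m (λ i → g i + - h i) ≡ sum< m g + - sum< m h
  sum<-− m g h = trans (sum<-∙ m g (λ i → - h i)) (cong (λ s → sum< m g + s) (sum<-neg m h))

  ⊛-distribˡ-⊖ : ∀ F G H → F ⊛ (G ⊖ H) ≈ F ⊛ G ⊖ F ⊛ H
  ⊛-distribˡ-⊖ F G H n d = begin
    (F ⊛ (G ⊖ H)) n d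
      ≡⟨ ⊛-sum< F (G ⊖ H) n d ⟩
    sum< (suc n) (λ i → sum< (suc d) (λ j → F i j * (G ⊖ H) (n ∸ i) (d ∸ j)))
      ≡⟨ sum<-cong (suc n) _ (λ i → FG i + - FH i) (λ i _ →
           trans (sum<-cong (suc d) _ (λ j → F i j * G (n ∸ i) (d ∸ j) + - (F i j * H (n ∸ i) (d ∸ j)))
                            λ j _ → distrib (F i j) _ _)
                 (sum<-− (suc d) (λ j → F i j * G (n ∸ i) (d ∸ j)) (λ j → F i j * H (n ∸ i) (d ∸ j)))) ⟩
    sum< (suc n) (λ i → FG i + - FH i)
      ≡⟨ sum<-− (suc n) FG FH ⟩
    sum< (suc n) FG + - sum< (suc n) FH
      ≡⟨ cong₂ (λ x y → x + - y) (⊛-sum< F G n d) (⊛-sum< F H n d) ⟨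
    (F ⊛ G ⊖ F ⊛ H) n d ∎
    where
      open ≡-Reasoning
      FG FH : ℕ → ℤ
      FG i = sum< (suc d) (λ j → F i j * G (n ∸ i) (d ∸ j))
      FH i = sum< (suc d) (λ j → F i j * H (n ∸ i) (d ∸ j))
      distrib : ∀ x y z → x * (y + - z) ≡ x * y + - (x * z)
      distrib x y z = trans (*-distribˡ-+ x y (- z)) (cong (λ s → x * y + s) (sym (neg-distribʳ-* x z)))

  private
    ∸≡ᵇ0-false : ∀ {i n} → i ≤ n → i ≢ n → (n ∸ i ≡ᵇ 0) ≡ false
    ∸≡ᵇ0-false {i} {n} i≤n i≢n =
      ≢⇒≡ᵇ-false (n ∸ i) 0 (λ n∸i≡0 → ℕ.<-irrefl (sym n∸i≡0) (m<n⇒0<n∸m (≤∧≢⇒< i≤n i≢n)))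

  -- 1 is a right unit: only the term i = n, j = d survives.
  ⊛-identityʳ : ∀ F → F ⊛ one ≈ F
  ⊛-identityʳ F n d = begin
    (F ⊛ one) n d
      ≡⟨ ⊛-sum< F one n d ⟩
    sum< (suc n) (λ i → sum< (suc d) (λ j → F i j * one (n ∸ i) (d ∸ j)))
      ≡⟨ sum<-single (suc n) (λ i → sum< (suc d) (λ j → F i j * one (n ∸ i) (d ∸ j))) n ≤-refl
           (λ i i≤n i≢n → sum<-zero (suc d) (λ j → F i j * one (n ∸ i) (d ∸ j)) λ j _ →
           trans (cong (λ b → F i j * (if b ∧ (d ∸ j ≡ᵇ 0) then + 1 else + 0)) (∸≡ᵇ0-false (≤-pred i≤n) i≢n))
                 (*-zeroʳ (F i j))) ⟩
    sum< (suc d) (λ j → F n j * one (n ∸ n) (d ∸ j))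
      ≡⟨ sum<-single (suc d) (λ j → F n j * one (n ∸ n) (d ∸ j)) d ≤-refl (λ j j≤d j≢d →
           trans (cong (λ b → F n j * (if (n ∸ n ≡ᵇ 0) ∧ b then + 1 else + 0)) (∸≡ᵇ0-false (≤-pred j≤d) j≢d))
                 (trans (cong (F n j *_) (if-∧-false (n ∸ n ≡ᵇ 0))) (*-zeroʳ (F n j)))) ⟩
    F n d * one (n ∸ n) (d ∸ d)
      ≡⟨ cong₂ (λ a b → F n d * one a b) (n∸n≡0 n) (n∸n≡0 d) ⟩
    F n d * + 1
      ≡⟨ *-identityʳ (F n d) ⟩
    F n d ∎
    where
      open ≡-Reasoning
      if-∧-false : ∀ b → (if b ∧ false then + 1 else + 0) ≡ + 0
      if-∧-false b rewrite ∧-zeroʳ b = refl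

  ⊛-tShift : ∀ F G → F ⊛ tShift G ≈ tShift (F ⊛ G)
  ⊛-tShift F G zero    d = trans (⊛-sum< F (tShift G) 0 d)
    (sum<-zero 1 (λ i → sum< (suc d) (λ j → F i j * tShift G (0 ∸ i) (d ∸ j)))
      λ { zero _ → sum<-zero (suc d) (λ j → F 0 j * + 0) λ j _ → *-zeroʳ (F 0 j) ; (suc _) (s≤s ()) })
  ⊛-tShift F G (suc n) d = begin
    (F ⊛ tShift G) (suc n) d
      ≡⟨ ⊛-sum< F (tShift G) (suc n) d ⟩
    sum< (suc (suc n)) term
      ≡⟨ sum<-last (suc n) term ⟩
    sum< (suc n) term + term (suc n)
      ≡⟨ cong₂ _+_ (sum<-cong (suc n) term _ shifted) last-vanishes ⟩
    sum< (suc n) (λ i → sum< (suc d) (λ j → F i j * G (n ∸ i) (d ∸ j))) + + 0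
      ≡⟨ +-identityʳ _ ⟩
    sum< (suc n) (λ i → sum< (suc d) (λ j → F i j * G (n ∸ i) (d ∸ j)))
      ≡⟨ ⊛-sum< F G n d ⟨
    (F ⊛ G) n d ∎
    where
      open ≡-Reasoning
      term : ℕ → ℤ
      term i = sum< (suc d) (λ j → F i j * tShift G (suc n ∸ i) (d ∸ j))
      last-vanishes : term (suc n) ≡ + 0
      last-vanishes = sum<-zero (suc d) (λ j → F (suc n) j * tShift G (suc n ∸ suc n) (d ∸ j)) λ j _ →
        trans (cong (λ m → F (suc n) j * tShift G m (d ∸ j)) (n∸n≡0 n)) (*-zeroʳ (F (suc n) j))
      shifted : ∀ i → i < suc n → term i ≡ sum< (suc d) (λ j → F i j * G (n ∸ i) (d ∸ j))
      shifted i i<1+n = sum<-cong (suc d) (λ j → F i j * tShift G (suc n ∸ i) (d ∸ j)) _ λ j _ →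
        cong (λ m → F i j * tShift G m (d ∸ j)) (+-∸-assoc 1 (≤-pred i<1+n))

  txm-⊛ : ∀ F → txm ⊛ F ≈ txShift F
  txm-⊛ F zero d = trans (⊛-sum< txm F 0 d)
    (sum<-zero 1 (λ i → sum< (suc d) (λ j → txm i j * F (0 ∸ i) (d ∸ j)))
      λ { zero _ → sum<-zero (suc d) (λ j → txm 0 j * F 0 (d ∸ j)) λ _ _ → refl ; (suc _) (s≤s ()) })
  txm-⊛ F (suc n) zero = trans (⊛-sum< txm F (suc n) 0)
    (sum<-zero (suc (suc n)) (λ i → sum< 1 (λ j → txm i j * F (suc n ∸ i) (0 ∸ j))) λ i _ →
      sum<-zero 1 (λ j → txm i j * F (suc n ∸ i) (0 ∸ j))
        λ { zero _ → cong (λ b → (if b then + 1 else + 0) * F (suc n ∸ i) 0) (∧-zeroʳ (i ≡ᵇ 1))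
          ; (suc _) (s≤s ()) })
  txm-⊛ F (suc n) (suc d) = begin
    (txm ⊛ F) (suc n) (suc d)
      ≡⟨ ⊛-sum< txm F (suc n) (suc d) ⟩
    sum< (suc (suc n)) (λ i → sum< (suc (suc d)) (λ j → txm i j * F (suc n ∸ i) (suc d ∸ j)))
      ≡⟨ sum<-single (suc (suc n)) (λ i → sum< (suc (suc d)) (λ j → txm i j * F (suc n ∸ i) (suc d ∸ j)))
           1 (s≤s (s≤s z≤n)) (λ i _ i≢1 →
             sum<-zero (suc (suc d)) (λ j → txm i j * F (suc n ∸ i) (suc d ∸ j)) λ j _ →
           cong (λ b → (if b ∧ (j ≡ᵇ 1) then + 1 else + 0) * F (suc n ∸ i) (suc d ∸ j)) (≢⇒≡ᵇ-false i 1 i≢1)) ⟩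
    sum< (suc (suc d)) (λ j → txm 1 j * F n (suc d ∸ j))
      ≡⟨ sum<-single (suc (suc d)) (λ j → txm 1 j * F n (suc d ∸ j)) 1 (s≤s (s≤s z≤n)) (λ j _ j≢1 →
           cong (λ b → (if b then + 1 else + 0) * F n (suc d ∸ j)) (≢⇒≡ᵇ-false j 1 j≢1)) ⟩
    + 1 * F n d
      ≡⟨ *-identityˡ (F n d) ⟩
    F n d ∎
    where open ≡-Reasoning

  inverse-from-recurrence : ∀ A E → (∀ d → A 0 d ≡ one 0 d) → (∀ n d → A (suc n) d ≡ (A ⊛ E) n d) →
    A ⊛ (one ⊖ tShift E) ≈ one
  inverse-from-recurrence A E A₀ A-rec n d = begin
    (A ⊛ (one ⊖ tShift E)) n d
      ≡⟨ ⊛-distribˡ-⊖ A one (tShift E) n d ⟩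
    (A ⊛ one) n d + - (A ⊛ tShift E) n d
      ≡⟨ cong₂ (λ x y → x + - y) (⊛-identityʳ A n d) (⊛-tShift A E n d) ⟩
    A n d + - tShift (A ⊛ E) n d
      ≡⟨ constant-and-recurrence n ⟩
    one n d ∎
    where
      open ≡-Reasoning
      constant-and-recurrence : ∀ n → A n d + - tShift (A ⊛ E) n d ≡ one n d
      constant-and-recurrence zero    = trans (+-identityʳ (A 0 d)) (A₀ d)
      constant-and-recurrence (suc n) = trans (cong (λ x → x + - (A ⊛ E) n d) (A-rec n d)) (+-inverseʳ ((A ⊛ E) n d))

  module ℕΣ = FiniteSums ℕ.+-0-isCommutativeMonoid

  pos-sum< : ∀ m (g : ℕ → ℕ) → + (ℕΣ.sum< m g) ≡ sum< m (λ i → + g i)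
  pos-sum< zero    g = refl
  pos-sum< (suc m) g = trans (pos-+ (g 0) _) (cong (λ s → + g 0 + s) (pos-sum< m (g ∘ suc)))

module Identification where

  open ListCounting using (length-filter; count-none; count-cong)
  open Permutations using (IsPerm231; perms231⁻; perm-surjective; interval⁺)
  open Statistics
  open Recurrence
  open Series
  open import Data.Nat using (zero; _∸_; _≤ᵇ_; _≡ᵇ_; z≤n; s≤s)
  open import Data.Integer using (+_; -_; _+_; _*_)
  open import Data.Integer.Properties using (pos-*)
  open import Data.Bool.Properties using (∧-zeroʳ)
  open import Data.List using ([]; _∷_)
  open import Data.List.Membership.Propositional using (_∈_)
  open import Data.Product using (∃; _,_)
  open import Data.Bool using (false; _∧_)

  A231≡a : ∀ k n d → A231 k n d ≡ + a k n d
  A231≡a k n d = cong +_ (length-filter (counted k d) (perms231 n))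

  E : ℕ → FPS
  E k m j = + e k m j

  A231-recurrence : ∀ k n d → A231 k (suc n) d ≡ (A231 k ⊛ E k) n d
  A231-recurrence k n d = begin
    A231 k (suc n) d
      ≡⟨ A231≡a k (suc n) d ⟩
    + a k (suc n) d
      ≡⟨ cong +_ (a-recurrence k n d) ⟩
    + ℕΣ.sum< (suc n) (λ p → ℕΣ.sum< (suc d) (λ j → a k p j ℕ* e k (n ∸ p) (d ∸ j)))
      ≡⟨ pos-sum< (suc n) (λ p → ℕΣ.sum< (suc d) (λ j → a k p j ℕ* e k (n ∸ p) (d ∸ j))) ⟩
    sum< (suc n) (λ p → + ℕΣ.sum< (suc d) (λ j → a k p j ℕ* e k (n ∸ p) (d ∸ j)))
      ≡⟨ sum<-cong (suc n) _ _ (λ p _ →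
           trans (pos-sum< (suc d) (λ j → a k p j ℕ* e k (n ∸ p) (d ∸ j))) (sum<-cong (suc d) _ _ λ j _ →
           trans (pos-* (a k p j) _) (cong (_* E k (n ∸ p) (d ∸ j)) (sym (A231≡a k p j))))) ⟩
    sum< (suc n) (λ p → sum< (suc d) (λ j → A231 k p j * E k (n ∸ p) (d ∸ j)))
      ≡⟨ ⊛-sum< (A231 k) (E k) n d ⟨
    (A231 k ⊛ E k) n d ∎
    where
      open ≡-Reasoning
      open import Data.Nat using () renaming (_*_ to _ℕ*_)

  -- the empty permutation is the only one of length 0
  A231-constant : ∀ k d → A231 k 0 d ≡ one 0 d
  A231-constant k zero    = refl
  A231-constant k (suc d) = refl

  A231-inverse : ∀ k → A231 k ⊛ (one ⊖ tShift (E k)) ≈ one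
  A231-inverse k = inverse-from-recurrence (A231 k) (E k) (A231-constant k) (A231-recurrence k)

  -- E⁽⁰⁾ = 1: a nonempty β has its entry 1 at a position ≥ 2 of n+1 β.
  E-zero-nonempty : ∀ m j → e 0 (suc m) j ≡ 0
  E-zero-nonempty m j = count-none (countedFactor 0 j) (perms231 (suc m)) λ {β} β∈ →
    cong (_∧ (des′ β ≡ᵇ j)) (maxdropFrom-has-drop 0 β (one∈ β∈))
    where
      one∈ : ∀ {β} → β ∈ perms231 (suc m) → 1 ∈ β
      one∈ β∈ = perm-surjective (perms231⁻ (suc m) β∈) (interval⁺ (s≤s z≤n , s≤s z≤n))

  factor-zero : one ⊖ tt ≈ one ⊖ tShift (E 0)
  factor-zero zero          j       = refl
  factor-zero (suc zero)    zero    = refl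
  factor-zero (suc zero)    (suc j) = refl
  factor-zero (suc (suc m)) j       rewrite E-zero-nonempty m j = refl

  -- For nonempty β, des' β ≥ 1 and (maxdrop' β ≤ k+1 iff maxdrop β ≤ k), so
  -- E⁽ᵏ⁺¹⁾ = 1 + x (A⁽ᵏ⁾ - 1).
  nonempty : ∀ m {β} → β ∈ perms231 (suc m) → ∃ λ x → ∃ λ xs → β ≡ x ∷ xs
  nonempty m {x ∷ xs} _  = x , xs , refl
  nonempty m {[]}     β∈ with () ← IsPerm231.length≡ (perms231⁻ (suc m) β∈)

  E-suc-constant : ∀ k m → e k (suc m) 0 ≡ 0
  E-suc-constant k m = count-none (countedFactor k 0) (perms231 (suc m)) λ β∈ → no-zero (nonempty m β∈)
    where
      no-zero : ∀ {β} → ∃ (λ x → ∃ λ xs → β ≡ x ∷ xs) → countedFactor k 0 β ≡ false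
      no-zero (x , xs , refl) = ∧-zeroʳ _

  E-suc : ∀ k m j → e (suc k) (suc m) (suc j) ≡ a k (suc m) j
  E-suc k m j = count-cong (countedFactor (suc k) (suc j)) (counted k j) (perms231 (suc m)) λ β∈ → shift (nonempty m β∈)
    where
      shift : ∀ {β} → ∃ (λ x → ∃ λ xs → β ≡ x ∷ xs) → countedFactor (suc k) (suc j) β ≡ counted k j β
      shift (x , xs , refl) = cong (_∧ (des (x ∷ xs) ≡ᵇ j)) (maxdropFrom-suc-≤ᵇ 1 (x ∷ xs) k)

  factor-suc : ∀ k → one ⊖ tt ⊕ txm ⊖ txm ⊛ A231 k ≈ one ⊖ tShift (E (suc k))
  factor-suc k m j rewrite txm-⊛ (A231 k) m j = by-coefficient m j
    where
      by-coefficient : ∀ m j → (one ⊖ tt ⊕ txm) m j + - txShift (A231 k) m j ≡ (one ⊖ tShift (E (suc k))) m j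
      by-coefficient zero          zero          = refl
      by-coefficient zero          (suc j)       = refl
      by-coefficient (suc zero)    zero          = refl
      by-coefficient (suc zero)    (suc zero)    = refl
      by-coefficient (suc zero)    (suc (suc j)) = refl
      by-coefficient (suc (suc m)) zero    rewrite E-suc-constant (suc k) m = refl
      by-coefficient (suc (suc m)) (suc j) rewrite A231≡a k (suc m) j | E-suc k m j = refl

open Series using (⊛-congʳ)
open Identification using (A231-inverse; factor-zero; factor-suc)
open import Data.Product using (_,_)

theorem1 : (A231 0 ⊛ (one ⊖ tt) ≈ one)
           × (∀ (k : ℕ) → A231 (suc k) ⊛ (one ⊖ tt ⊕ txm ⊖ txm ⊛ A231 k) ≈ one)
theorem1 = k-zero , k-suc
  where
    k-zero : A231 0 ⊛ (one ⊖ tt) ≈ one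
    k-zero n d = trans (⊛-congʳ (A231 0) factor-zero n d) (A231-inverse 0 n d)
    k-suc : ∀ k → A231 (suc k) ⊛ (one ⊖ tt ⊕ txm ⊖ txm ⊛ A231 k) ≈ one
    k-suc k n d = trans (⊛-congʳ (A231 (suc k)) (factor-suc k) n d) (A231-inverse (suc k) n d)
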